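{- Let $r>0$ be an integer and let $M$ be an $r$-mountain. Then for all integers $a,b>0$ with $a+b=r+1$ and every $2$-colouring $\phi: V(M)\to\{\text{red},\text{blue}\}$, the tournament $M$ contains either an $a$-mountain all of whose vertices are red or a $b$-mountain all of whose vertices are blue.
   Context: A tournament is a finite directed graph with exactly one arc between each pair of distinct vertices. For disjoint vertex sets $X,Y$, $X\Rightarrow Y$ means $xy$ is an arc for all $x\in X,y\in Y$. Mountains are defined inductively inside a tournament $T$. A $1$-mountain is a single-vertex (induced) subtournament. For $r>0$, an arc $uv$ of $T$ is $r$-heavy if there is an $r$-mountain $M$ in $T$ with $V(M)\Rightarrow u$ and $v\Rightarrow V(M)$; otherwise it is $r$-light. For $r,s>0$, an $(r,s)$-clique is a set $K\subseteq V(T)$ of size $s$ such that every arc of $T[K]$ is $r$-heavy. An $(r,s)$-mountain is a minimal induced subtournament $T'$ of $T$ containing an $(r,s)$-clique (with heaviness certified by mountains inside $T'$), i.e. an $(r,s)$-clique together with mountains witnessing the heaviness of its arcs. For $r>0$, an $(r+1)$-mountain means an $(r,r+1)$-mountain. A tournament $M$ is an $r$-mountain if it is an $r$-mountain in itself; "$M$ contains an $a$-mountain" means some induced subtournament of $M$ is an $a$-mountain. -}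

module Defs where

open import Data.Nat using (ℕ; zero; suc)
open import Data.Fin using (Fin)
open import Data.Fin.Subset using (Subset; _∈_; _⊆_; _⊂_; ∣_∣; ⊤)
open import Data.Bool using (Bool; true; false; T)
open import Data.Product using (Σ; _×_; ∃)
open import Data.Sum using (_⊎_)
open import Data.Empty using (⊥)
open import Relation.Nullary using (¬_)
open import Relation.Binary.PropositionalEquality using (_≡_; _≢_)

record Tournament (n : ℕ) : Set where
  field
    arc     : Fin n → Fin n → Bool
    irrefl  : ∀ x → ¬ T (arc x x)
    total   : ∀ x y → x ≢ y → T (arc x y) ⊎ T (arc y x)
    asym    : ∀ x y → T (arc x y) → ¬ T (arc y x)

open Tournament public

module _ {n : ℕ} (G : Tournament n) where

  _⇒v_ : Subset n → Fin n → Set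
  X ⇒v u = ∀ x → x ∈ X → T (arc G x u)

  _v⇒_ : Fin n → Subset n → Set
  u v⇒ X = ∀ x → x ∈ X → T (arc G u x)

  mutual
    -- IsMountain r S : the induced subtournament G[S] is an r-mountain
    -- (in itself).  Every notion below only looks inside S, so it is
    -- intrinsic to G[S].
    IsMountain : ℕ → Subset n → Set
    IsMountain zero S = ⊥
    IsMountain (suc zero) S = ∣ S ∣ ≡ 1
    IsMountain (suc (suc r)) S = IsClqMountain (suc r) (suc (suc r)) S

    Heavy : ℕ → Subset n → Fin n → Fin n → Set
    Heavy r S u v = Σ (Subset n) λ M → M ⊆ S × IsMountain r M × (M ⇒v u) × (v v⇒ M)

    HasClique : ℕ → ℕ → Subset n → Set
    HasClique r s S = Σ (Subset n) λ K → K ⊆ S × ∣ K ∣ ≡ s ×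
      (∀ u v → u ∈ K → v ∈ K → T (arc G u v) → Heavy r S u v)

    IsClqMountain : ℕ → ℕ → Subset n → Set
    IsClqMountain r s S = HasClique r s S × (∀ S' → S' ⊂ S → ¬ HasClique r s S')

  ContainsMonoMountain : ℕ → (Fin n → Bool) → Bool → Set
  ContainsMonoMountain a φ c =
    Σ (Subset n) λ S → IsMountain a S × (∀ x → x ∈ S → φ x ≡ c)

red blue : Bool
red = true
blue = false

-- Induction on a + b.  If a = 1, either M has a red vertex or all of M is blue (and
-- symmetrically if b = 1).  Otherwise M, an (a+b-1)-mountain, contains an (a+b-2, a+b-1)-clique
-- K, and by pigeonhole K has a red part of size a or a blue part of size b; say red.  Each arc
-- uv of that red part is witnessed by an (a+b-2)-mountain N, which by induction contains a
-- blue b-mountain (and we are done) or a red (a-1)-mountain; the latter witnesses uv inside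
-- the red vertices of M.  So if M has no blue b-mountain, the red part is an (a-1, a)-clique
-- among the red vertices, and a minimal red set containing it is a red a-mountain.
module Submission where

open import Defs
open import Data.Nat using (ℕ; zero; suc; _+_; _≥_; _≤_; s≤s; z≤n)
open import Data.Nat.Induction using (<-wellFounded)
open import Data.Nat.Properties using (_≟_; +-suc; +-identityʳ; +-comm; suc-injective; ≤-reflexive)
open import Data.Fin using (Fin; zero; suc)
open import Data.Fin.Subset using (Subset; ⊤; _∈_; _⊆_; _⊂_; _∩_; ∣_∣; ⁅_⁆; inside; outside)
  renaming (⊥ to ∅)
open import Data.Fin.Subset.Properties
  using (_∈?_; _⊆?_; _⊂?_; anySubset?; p⊂q⇒∣p∣<∣q∣; ∉⊥; ∣⊥∣≡0; x∈⁅y⁆⇒x≡y; ∣⁅x⁆∣≡1;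
         out⊆; in⊆in; ⊆-trans; p⊂q⇒p⊆q; p∩q⊆p; x∈p∩q⁺; x∈p∩q⁻)
open import Data.Fin.Properties using (any?; all?)
open import Data.Bool using (Bool; T; not)
open import Data.Bool.Properties using (T?; T-≡; ¬-not; not-involutive) renaming (_≟_ to _≟ᵇ_)
open import Data.Vec using ([]; _∷_; tabulate; here; there)
open import Data.Vec.Properties using (lookup∘tabulate; []=⇒lookup; lookup⇒[]=)
open import Data.Sum using (_⊎_; inj₁; inj₂; swap; [_,_]′) renaming (map to map⊎; map₂ to map⊎₂)
open import Data.Product using (_×_; _,_; ∃; proj₂)
open import Data.Empty using (⊥-elim)
open import Level using (0ℓ)
open import Function using (_∘_; id)
open import Function.Bundles using (Equivalence)
open import Induction.WellFounded using (WellFounded; Acc; acc; module Subrelation)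
open import Relation.Binary.Construct.On as On using ()
open import Relation.Nullary using (¬_; Dec; yes; no)
open import Relation.Nullary.Decidable using (_×-dec_; _→-dec_; ¬?; map′; isYes; toWitness; fromWitness)
open import Relation.Unary using (Pred; Decidable)
open import Relation.Binary.PropositionalEquality using (_≡_; subst; sym; trans; cong)

module _ {n : ℕ} where

  select : {P : Pred (Fin n) 0ℓ} → Decidable P → Subset n
  select P? = tabulate (isYes ∘ P?)

  ∈-select⁺ : {P : Pred (Fin n) 0ℓ} (P? : Decidable P) {x : Fin n} → P x → x ∈ select P?
  ∈-select⁺ P? {x} px =
    lookup⇒[]= x _ (trans (lookup∘tabulate (isYes ∘ P?) x) (Equivalence.to T-≡ (fromWitness px)))

  ∈-select⁻ : {P : Pred (Fin n) 0ℓ} (P? : Decidable P) {x : Fin n} → x ∈ select P? → P x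
  ∈-select⁻ P? {x} x∈ =
    toWitness {a? = P? x}
      (Equivalence.from T-≡ (trans (sym (lookup∘tabulate (isYes ∘ P?) x)) ([]=⇒lookup x∈)))

  ⊂-wellFounded : WellFounded (_⊂_ {n})
  ⊂-wellFounded = Subrelation.wellFounded p⊂q⇒∣p∣<∣q∣ (On.wellFounded ∣_∣ <-wellFounded)

  Minimal : Pred (Subset n) 0ℓ → Pred (Subset n) 0ℓ
  Minimal P S = ∀ S' → S' ⊂ S → ¬ P S'

  minimal? : {P : Pred (Subset n) 0ℓ} → Decidable P → Decidable (Minimal P)
  minimal? P? S = map′ (λ ∄smaller S' S'⊂S pS' → ∄smaller (S' , S'⊂S , pS'))
                       (λ minS (S' , S'⊂S , pS') → minS S' S'⊂S pS')
                       (¬? (anySubset? λ S' → (S' ⊂? S) ×-dec P? S'))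

  minimal-⊆ : {P : Pred (Subset n) 0ℓ} → Decidable P → ∀ {X} → P X → ∃ λ Y → Y ⊆ X × P Y × Minimal P Y
  minimal-⊆ {P} P? {X} = go (⊂-wellFounded X)
    where
    go : ∀ {X} → Acc _⊂_ X → P X → ∃ λ Y → Y ⊆ X × P Y × Minimal P Y
    go {X} (acc rec) pX with anySubset? (λ X' → (X' ⊂? X) ×-dec P? X')
    ... | no ∄smaller = X , id , pX , λ X' X'⊂X pX' → ∄smaller (X' , X'⊂X , pX')
    ... | yes (X' , X'⊂X , pX') with go (rec X'⊂X) pX'
    ...   | Y , Y⊆X' , pY , minY = Y , ⊆-trans Y⊆X' (p⊂q⇒p⊆q X'⊂X) , pY , minY

module _ {m : ℕ} (ψ : Fin m → Bool) where

  Monochromatic : Bool → Subset m → Set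
  Monochromatic c X = ∀ x → x ∈ X → ψ x ≡ c

  monochromatic? : ∀ c X → Dec (Monochromatic c X)
  monochromatic? c X = all? λ x → (x ∈? X) →-dec (ψ x ≟ᵇ c)

  colourClass : Bool → Subset m
  colourClass c = select (λ x → ψ x ≟ᵇ c)

  ⊆-∩-colourClass : ∀ {c S X} → X ⊆ S → Monochromatic c X → X ⊆ S ∩ colourClass c
  ⊆-∩-colourClass X⊆S monoX x∈X = x∈p∩q⁺ (X⊆S x∈X , ∈-select⁺ (λ x → ψ x ≟ᵇ _) (monoX _ x∈X))

  ∩-colourClass-monochromatic : ∀ c S → Monochromatic c (S ∩ colourClass c)
  ∩-colourClass-monochromatic c S x x∈ = ∈-select⁻ (λ x → ψ x ≟ᵇ c) (proj₂ (x∈p∩q⁻ S (colourClass c) x∈))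

module _ {m : ℕ} (ψ : Fin m → Bool) (c : Bool) where

  MonoSubset : Subset m → ℕ → Set
  MonoSubset K a = ∃ λ K' → K' ⊆ K × ∣ K' ∣ ≡ a × Monochromatic ψ c K'

  empty-MonoSubset : ∀ K → MonoSubset K 0
  empty-MonoSubset K = ∅ , (λ x∈∅ → ⊥-elim (∉⊥ x∈∅)) , ∣⊥∣≡0 m , λ _ x∈∅ → ⊥-elim (∉⊥ x∈∅)

module _ {m : ℕ} {ψ : Fin (suc m) → Bool} {c : Bool} where

  skip-MonoSubset : ∀ {s K a} → MonoSubset (ψ ∘ suc) c K a → MonoSubset ψ c (s ∷ K) a
  skip-MonoSubset (K' , K'⊆K , ∣K'∣ , monoK') =
    outside ∷ K' , out⊆ K'⊆K , ∣K'∣ , λ { (suc x) (there x∈K') → monoK' x x∈K' }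

  keep-MonoSubset : ∀ {K a} → ψ zero ≡ c → MonoSubset (ψ ∘ suc) c K a → MonoSubset ψ c (inside ∷ K) (suc a)
  keep-MonoSubset ψ0≡c (K' , K'⊆K , ∣K'∣ , monoK') =
    inside ∷ K' , in⊆in K'⊆K , cong suc ∣K'∣ , λ { zero here → ψ0≡c ; (suc x) (there x∈K') → monoK' x x∈K' }

pigeonhole : ∀ {m} (ψ : Fin m → Bool) c (K : Subset m) a b → a + b ≤ suc ∣ K ∣ →
             MonoSubset ψ c K a ⊎ MonoSubset ψ (not c) K b
pigeonhole ψ c K zero b _ = inj₁ (empty-MonoSubset ψ c K)
pigeonhole ψ c K (suc a) zero _ = inj₂ (empty-MonoSubset ψ (not c) K)
pigeonhole ψ c [] (suc a) (suc b) (s≤s a+1+b≤0) with () ← subst (_≤ 0) (+-suc a b) a+1+b≤0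
pigeonhole ψ c (outside ∷ K) (suc a) (suc b) a+b≤ =
  map⊎ skip-MonoSubset skip-MonoSubset (pigeonhole (ψ ∘ suc) c K (suc a) (suc b) a+b≤)
pigeonhole ψ c (inside ∷ K) (suc a) (suc b) (s≤s a+b≤) with ψ zero ≟ᵇ c
... | yes ψ0≡c =
  map⊎ (keep-MonoSubset ψ0≡c) skip-MonoSubset (pigeonhole (ψ ∘ suc) c K a (suc b) a+b≤)
... | no ψ0≢c =
  map⊎ skip-MonoSubset (keep-MonoSubset (¬-not ψ0≢c))
       (pigeonhole (ψ ∘ suc) c K (suc a) b (subst (_≤ suc ∣ K ∣) (+-suc a b) a+b≤))

module _ {n : ℕ} (G : Tournament n) where

  ⇒v? : ∀ X u → Dec (_⇒v_ G X u)
  ⇒v? X u = all? λ x → (x ∈? X) →-dec T? (arc G x u)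

  v⇒? : ∀ v X → Dec (_v⇒_ G v X)
  v⇒? v X = all? λ x → (x ∈? X) →-dec T? (arc G v x)

  mutual
    isMountain? : ∀ r S → Dec (IsMountain G r S)
    isMountain? zero S = no λ ()
    isMountain? (suc zero) S = ∣ S ∣ ≟ 1
    isMountain? (suc (suc r)) S = isClqMountain? (suc r) (suc (suc r)) S

    heavy? : ∀ r S u v → Dec (Heavy G r S u v)
    heavy? r S u v = anySubset? λ M → (M ⊆? S) ×-dec isMountain? r M ×-dec ⇒v? M u ×-dec v⇒? v M

    hasClique? : ∀ r s S → Dec (HasClique G r s S)
    hasClique? r s S = anySubset? λ K → (K ⊆? S) ×-dec (∣ K ∣ ≟ s) ×-dec
      all? λ u → all? λ v → (u ∈? K) →-dec (v ∈? K) →-dec T? (arc G u v) →-dec heavy? r S u v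

    isClqMountain? : ∀ r s S → Dec (IsClqMountain G r s S)
    isClqMountain? r s S = hasClique? r s S ×-dec minimal? (hasClique? r s) S

  AllArcsHeavy : ℕ → Subset n → Subset n → Set
  AllArcsHeavy r S K = ∀ u v → u ∈ K → v ∈ K → T (arc G u v) → Heavy G r S u v

module _ {n : ℕ} (G : Tournament n) (φ : Fin n → Bool) where

  MonoMountainIn : ℕ → Bool → Subset n → Set
  MonoMountainIn a c S = ∃ λ S' → S' ⊆ S × IsMountain G a S' × Monochromatic φ c S'

  monoMountainIn? : ∀ a c S → Dec (MonoMountainIn a c S)
  monoMountainIn? a c S =
    anySubset? λ S' → (S' ⊆? S) ×-dec isMountain? G a S' ×-dec monochromatic? φ c S'

  monoMountainIn-⊆ : ∀ {a c N S} → N ⊆ S → MonoMountainIn a c N → MonoMountainIn a c S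
  monoMountainIn-⊆ N⊆S (S' , S'⊆N , mS' , monoS') = S' , ⊆-trans S'⊆N N⊆S , mS' , monoS'

  vertex-or-whole : ∀ {r S} → IsMountain G r S → ∀ c → MonoMountainIn 1 c S ⊎ MonoMountainIn r (not c) S
  vertex-or-whole {S = S} mS c with any? (λ x → (x ∈? S) ×-dec (φ x ≟ᵇ c))
  ... | yes (x , x∈S , φx≡c) =
    inj₁ (⁅ x ⁆ , ⁅x⁆⊆S , ∣⁅x⁆∣≡1 x , λ y y∈⁅x⁆ → subst (λ z → φ z ≡ c) (sym (x∈⁅y⁆⇒x≡y x y∈⁅x⁆)) φx≡c)
    where
    ⁅x⁆⊆S : ⁅ x ⁆ ⊆ S
    ⁅x⁆⊆S y∈⁅x⁆ = subst (_∈ S) (sym (x∈⁅y⁆⇒x≡y x y∈⁅x⁆)) x∈S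
  ... | no ∄x = inj₂ (S , id , mS , λ x x∈S → ¬-not λ φx≡c → ∄x (x , x∈S , φx≡c))

  heavy-∩-colourClass : ∀ {r a c S u v} → (∀ N → N ⊆ S → IsMountain G r N → MonoMountainIn a c N) →
                        Heavy G r S u v → Heavy G a (S ∩ colourClass φ c) u v
  heavy-∩-colourClass witnesses-contain (N , N⊆S , mN , N⇒u , v⇒N) with witnesses-contain N N⊆S mN
  ... | M , M⊆N , mM , monoM =
    M , ⊆-∩-colourClass φ (⊆-trans M⊆N N⊆S) monoM , mM , (λ x x∈M → N⇒u x (M⊆N x∈M)) , λ x x∈M → v⇒N x (M⊆N x∈M)

  grow-mountain : ∀ {r a c S K} → K ⊆ S → AllArcsHeavy G r S K → MonoSubset φ c K (suc (suc a)) →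
                  (∀ N → N ⊆ S → IsMountain G r N → MonoMountainIn (suc a) c N) →
                  MonoMountainIn (suc (suc a)) c S
  grow-mountain {a = a} {c = c} {S = S} K⊆S heavyK (K' , K'⊆K , ∣K'∣ , monoK') witnesses-contain =
    let Y , Y⊆R , cliqueY , minY = minimal-⊆ (hasClique? G (suc a) (suc (suc a))) cliqueR
    in Y , ⊆-trans Y⊆R (p∩q⊆p S _) , (cliqueY , minY) , λ x x∈Y → ∩-colourClass-monochromatic φ c S x (Y⊆R x∈Y)
    where
    R : Subset n
    R = S ∩ colourClass φ c
    cliqueR : HasClique G (suc a) (suc (suc a)) R
    cliqueR = K' , ⊆-∩-colourClass φ (⊆-trans K'⊆K K⊆S) monoK' , ∣K'∣ ,
              λ u v u∈K' v∈K' uv → heavy-∩-colourClass witnesses-contain (heavyK u v (K'⊆K u∈K') (K'⊆K v∈K') uv)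

  grow-mountain-or : ∀ {r a b c c' S K} → K ⊆ S → AllArcsHeavy G r S K → MonoSubset φ c K (suc (suc a)) →
                     (∀ N → N ⊆ S → IsMountain G r N → MonoMountainIn (suc a) c N ⊎ MonoMountainIn b c' N) →
                     MonoMountainIn (suc (suc a)) c S ⊎ MonoMountainIn b c' S
  grow-mountain-or {b = b} {c' = c'} {S} K⊆S heavyK monoK' witnesses-split with monoMountainIn? b c' S
  ... | yes other = inj₂ other
  ... | no ¬other = inj₁ (grow-mountain K⊆S heavyK monoK' λ N N⊆S mN →
          [ id , ⊥-elim ∘ ¬other ∘ monoMountainIn-⊆ N⊆S ]′ (witnesses-split N N⊆S mN))

  mono-mountain : ∀ a b S → IsMountain G (suc (a + b)) S → ∀ c →
                  MonoMountainIn (suc a) c S ⊎ MonoMountainIn (suc b) (not c) S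
  mono-mountain zero b S mS c = vertex-or-whole mS c
  mono-mountain (suc a) zero S mS c =
    swap (map⊎₂ (subst (λ c' → MonoMountainIn (suc (suc a)) c' S) (not-involutive c))
                (vertex-or-whole (subst (λ k → IsMountain G (suc k) S) (+-identityʳ (suc a)) mS) (not c)))
  mono-mountain (suc a) (suc b) S ((K , K⊆S , ∣K∣ , heavyK) , _) c
    with pigeonhole φ c K (suc (suc a)) (suc (suc b)) pigeonhole-bound
    where
    pigeonhole-bound : suc (suc a) + suc (suc b) ≤ suc ∣ K ∣
    pigeonhole-bound = ≤-reflexive (cong suc (sym (trans ∣K∣ (cong suc (sym (+-suc a (suc b)))))))
  ... | inj₁ red-part = grow-mountain-or K⊆S heavyK red-part λ N _ mN → mono-mountain a (suc b) N mN c
  ... | inj₂ blue-part = swap (grow-mountain-or K⊆S heavyK blue-part λ N _ mN →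
          swap (mono-mountain (suc a) b N (subst (λ k → IsMountain G (suc k) N) (+-suc a b) mN) c))

lemma4p2 : (r : ℕ) → r ≥ 1 → (n : ℕ) → (M : Tournament n) → IsMountain M r ⊤ →
    (a b : ℕ) → a ≥ 1 → b ≥ 1 → a + b ≡ r + 1 → (φ : Fin n → Bool) →
    ContainsMonoMountain M a φ red ⊎ ContainsMonoMountain M b φ blue
lemma4p2 (suc r) (s≤s z≤n) n M mM (suc a) (suc b) (s≤s z≤n) (s≤s z≤n) sum-eq φ =
  map⊎ forget-⊆ forget-⊆ (mono-mountain M φ a b ⊤ (subst (λ k → IsMountain M (suc k) ⊤) (sym a+b≡r) mM) red)
  where
  a+b≡r : a + b ≡ r
  a+b≡r = suc-injective (trans (sym (+-suc a b)) (trans (suc-injective sum-eq) (+-comm r 1)))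

  forget-⊆ : ∀ {k c} → MonoMountainIn M φ k c ⊤ → ContainsMonoMountain M k φ c
  forget-⊆ (S , _ , mS , monoS) = S , mS , monoS
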